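{- Let $R,c$ be positive integers with $\gcd(c,R)=1$, and let $m$ be a positive integer. Let $P_0$ be the integer with $1\le P_0<R$ and $cP_0\equiv1\pmod R$, put $S_0=(cP_0-1)/R$, and for integers $t\ge0$ define \[D(t)=(S_0+ct)^2-4(P_0+tR).\] Then there exist primes $u<v$ with $u>m$ and $cuv-R(u+v)=1$ if and only if there exists an integer $t\ge0$ such that $D(t)$ is a perfect square, the numbers \[u=\frac{S_0+ct-\sqrt{D(t)}}2,\qquad v=\frac{S_0+ct+\sqrt{D(t)}}2\] are primes, and $u>m$. -}

module Defs where

open import Data.Nat using (ℕ; _+_; _*_; _∸_; NonZero)
open import Data.Nat.DivMod using (_/_)
open import Data.Integer as ℤ using (ℤ; +_; _-_)

-- S₀ = (c P₀ - 1) / R  (exact division under the hypothesis c P₀ ≡ 1 mod R)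
S₀ : (R c P₀ : ℕ) → .{{NonZero R}} → ℕ
S₀ R c P₀ = (c * P₀ ∸ 1) / R

D : (R c P₀ : ℕ) → .{{NonZero R}} → ℕ → ℤ
D R c P₀ t = (+ (S₀ R c P₀ + c * t)) ℤ.* (+ (S₀ R c P₀ + c * t)) - + (4 * (P₀ + t * R))

-- Any solution of c u v = R (u + v) + 1 has c (u v) ≡ 1 (mod R), so u v ≡ P₀ (mod R) as c is
-- invertible modulo R; writing u v = P₀ + t R, the equation then says exactly u + v = S₀ + c t.
-- Thus u and v are the roots of X² - (S₀ + c t) X + (P₀ + t R), whose discriminant is D(t) = (v - u)².
-- Conversely, roots read off from a square D(t) = k² satisfy both Vieta relations, hence the equation;
-- they are distinct because u = v would force u ∣ 1.
module Submission where

open import Defs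
open import Data.Nat using (ℕ; _+_; _*_; _∸_; _≤_; _<_; _%_; _/_; NonZero)
open import Data.Nat.Properties
open import Data.Nat.DivMod using (m≡m%n+[m/n]*n; [m+kn]%n≡m%n; m<n⇒m%n≡m; m*[n/m]≡n; %-congˡ; %-remove-+ʳ)
open import Data.Nat.Divisibility using (_∣_; divides; n∣m*n; n∣m*n*o; ∣m+n∣m⇒∣n; ∣1⇒≡1)
open import Data.Nat.Coprimality using (Coprime; coprime-divisor)
import Data.Nat.Coprimality as Coprimality
open import Data.Nat.Primality using (Prime; ¬prime[1])
open import Data.Integer using (+_)
import Data.Integer as ℤ
import Data.Integer.Properties as ℤ
open import Data.Nat.Tactic.RingSolver using (solve-∀)
import Data.Integer.Tactic.RingSolver as ℤ-Solver
open import Data.Product using (∃; _×_; _,_)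
open import Data.Sum using ([_,_]′)
open import Function.Bundles using (_⇔_; mk⇔; Equivalence)
open import Relation.Binary.PropositionalEquality
  using (_≡_; _≢_; refl; sym; trans; cong; cong₂; subst; module ≡-Reasoning)

open ≡-Reasoning
open Equivalence using (to; from)

m%d≡n%d⇒d∣m∸n : ∀ m n d .{{_ : NonZero d}} → m % d ≡ n % d → d ∣ m ∸ n
m%d≡n%d⇒d∣m∸n m n d e = divides (m / d ∸ n / d) (begin
  m ∸ n                                     ≡⟨ cong₂ _∸_ (m≡m%n+[m/n]*n m d) (m≡m%n+[m/n]*n n d) ⟩
  (m % d + m / d * d) ∸ (n % d + n / d * d) ≡⟨ cong (λ r → (r + m / d * d) ∸ (n % d + n / d * d)) e ⟩
  (n % d + m / d * d) ∸ (n % d + n / d * d) ≡⟨ [m+n]∸[m+o]≡n∸o (n % d) _ _ ⟩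
  m / d * d ∸ n / d * d                     ≡⟨ *-distribʳ-∸ d (m / d) (n / d) ⟨
  (m / d ∸ n / d) * d                       ∎)

d∣m∸n⇒m%d≡n%d : ∀ {m n d} .{{_ : NonZero d}} → n ≤ m → d ∣ m ∸ n → m % d ≡ n % d
d∣m∸n⇒m%d≡n%d {m} {n} {d} n≤m d∣m∸n = begin
  m % d             ≡⟨ %-congˡ (m+[n∸m]≡n n≤m) ⟨
  (n + (m ∸ n)) % d ≡⟨ %-remove-+ʳ n d∣m∸n ⟩
  n % d             ∎

c*m%d≡c*n%d⇒m%d≡n%d : ∀ {c d} m n .{{_ : NonZero d}} → Coprime d c →
                       (c * m) % d ≡ (c * n) % d → m % d ≡ n % d
c*m%d≡c*n%d⇒m%d≡n%d {c} {d} m n d⊥c e =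
  [ (λ n≤m → cancel n≤m e) , (λ m≤n → sym (cancel m≤n (sym e))) ]′ (≤-total n m)
  where
  cancel : ∀ {x y} → y ≤ x → (c * x) % d ≡ (c * y) % d → x % d ≡ y % d
  cancel {x} {y} y≤x cx≡cy = d∣m∸n⇒m%d≡n%d y≤x (coprime-divisor d⊥c
    (subst (d ∣_) (sym (*-distribˡ-∸ c x y)) (m%d≡n%d⇒d∣m∸n (c * x) (c * y) d cx≡cy)))

m%n≡1%n⇒n*[[m∸1]/n]+1≡m : ∀ m n .{{_ : NonZero n}} → 1 ≤ m → m % n ≡ 1 % n → n * ((m ∸ 1) / n) + 1 ≡ m
m%n≡1%n⇒n*[[m∸1]/n]+1≡m m n 1≤m e = begin
  n * ((m ∸ 1) / n) + 1 ≡⟨ cong (_+ 1) (m*[n/m]≡n (m%d≡n%d⇒d∣m∸n m 1 n e)) ⟩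
  m ∸ 1 + 1             ≡⟨ m∸n+n≡m 1≤m ⟩
  m                     ∎

c*u*v≡R*[u+v]+1⇒c*[u*v]%R≡1%R : ∀ R c u v .{{_ : NonZero R}} →
                                  c * u * v ≡ R * (u + v) + 1 → (c * (u * v)) % R ≡ 1 % R
c*u*v≡R*[u+v]+1⇒c*[u*v]%R≡1%R R c u v eq = begin
  (c * (u * v)) % R       ≡⟨ %-congˡ (*-assoc c u v) ⟨
  (c * u * v) % R         ≡⟨ %-congˡ (trans eq (R*s+1≡1+s*R R (u + v))) ⟩
  (1 + (u + v) * R) % R   ≡⟨ [m+kn]%n≡m%n 1 (u + v) R ⟩
  1 % R                   ∎
  where
  R*s+1≡1+s*R : ∀ R s → R * s + 1 ≡ 1 + s * R
  R*s+1≡1+s*R = solve-∀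

c*u*v≡R*[u+v]+1⇒u≡v⇒u≡1 : ∀ R c u v → c * u * v ≡ R * (u + v) + 1 → u ≡ v → u ≡ 1
c*u*v≡R*[u+v]+1⇒u≡v⇒u≡1 R c u .u eq refl = ∣1⇒≡1 (∣m+n∣m⇒∣n u∣R*[u+u]+1 u∣R*[u+u])
  where
  u∣R*[u+u]+1 : u ∣ R * (u + u) + 1
  u∣R*[u+u]+1 = subst (u ∣_) eq (n∣m*n*o c u)
  u∣R*[u+u] : u ∣ R * (u + u)
  u∣R*[u+u] = subst (u ∣_) (R*2*u≡R*[u+u] R u) (n∣m*n (R * 2))
    where
    R*2*u≡R*[u+u] : ∀ R u → R * 2 * u ≡ R * (u + u)
    R*2*u≡R*[u+u] = solve-∀

+m-+n≡+o⇔m≡o+n : ∀ m n o → + m ℤ.- + n ≡ + o ⇔ m ≡ o + n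
+m-+n≡+o⇔m≡o+n m n o = mk⇔ to′ from′
  where
  sub-add : ∀ (i j : ℤ.ℤ) → (i ℤ.- j) ℤ.+ j ≡ i
  sub-add = ℤ-Solver.solve-∀
  add-sub : ∀ (i j : ℤ.ℤ) → (i ℤ.+ j) ℤ.- j ≡ i
  add-sub = ℤ-Solver.solve-∀
  to′ : + m ℤ.- + n ≡ + o → m ≡ o + n
  to′ e = ℤ.+-injective (begin
    + m                    ≡⟨ sub-add (+ m) (+ n) ⟨
    (+ m ℤ.- + n) ℤ.+ + n  ≡⟨ cong (ℤ._+ + n) e ⟩
    + o ℤ.+ + n            ≡⟨ ℤ.pos-+ o n ⟨
    + (o + n)              ∎)
  from′ : m ≡ o + n → + m ℤ.- + n ≡ + o
  from′ refl = begin
    + (o + n) ℤ.- + n         ≡⟨ cong (ℤ._- + n) (ℤ.pos-+ o n) ⟩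
    (+ o ℤ.+ + n) ℤ.- + n     ≡⟨ add-sub (+ o) (+ n) ⟩
    + o                       ∎

PrimeSolution : (R c m : ℕ) → Set
PrimeSolution R c m = ∃ λ u → ∃ λ v → Prime u × Prime v × u < v × m < u × c * u * v ≡ R * (u + v) + 1

PrimeRootsOfSquareDiscriminant : (R c m P₀ : ℕ) → .{{NonZero R}} → Set
PrimeRootsOfSquareDiscriminant R c m P₀ =
  ∃ λ t → ∃ λ k → D R c P₀ t ≡ + (k * k) ×
    (∃ λ u → ∃ λ v → 2 * u + k ≡ S₀ R c P₀ + c * t × 2 * v ≡ S₀ R c P₀ + c * t + k ×
      Prime u × Prime v × m < u)

u+[u+k]≡2*u+k : ∀ u k → u + (u + k) ≡ 2 * u + k
u+[u+k]≡2*u+k = solve-∀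

2*[u+k]≡2*u+k+k : ∀ u k → 2 * (u + k) ≡ 2 * u + k + k
2*[u+k]≡2*u+k+k = solve-∀

module _ (R c P₀ : ℕ) .{{_ : NonZero R}} (1≤c : 1 ≤ c) (1≤P₀ : 1 ≤ P₀) (cP₀≡1 : (c * P₀) % R ≡ 1 % R) where

  R*S₀+1≡c*P₀ : R * S₀ R c P₀ + 1 ≡ c * P₀
  R*S₀+1≡c*P₀ = m%n≡1%n⇒n*[[m∸1]/n]+1≡m (c * P₀) R (*-mono-≤ 1≤c 1≤P₀) cP₀≡1

  c*[P₀+t*R]≡R*[S₀+c*t]+1 : ∀ t → c * (P₀ + t * R) ≡ R * (S₀ R c P₀ + c * t) + 1
  c*[P₀+t*R]≡R*[S₀+c*t]+1 t = begin
    c * (P₀ + t * R)                ≡⟨ *-distribˡ-+ c P₀ (t * R) ⟩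
    c * P₀ + c * (t * R)            ≡⟨ cong (_+ c * (t * R)) R*S₀+1≡c*P₀ ⟨
    R * S₀ R c P₀ + 1 + c * (t * R) ≡⟨ regroup R (S₀ R c P₀) c t ⟩
    R * (S₀ R c P₀ + c * t) + 1     ∎
    where
    regroup : ∀ R s c t → R * s + 1 + c * (t * R) ≡ R * (s + c * t) + 1
    regroup = solve-∀

  c*n%R≡1%R⇒n≡P₀+[n/R]*R : Coprime c R → P₀ < R → ∀ n → (c * n) % R ≡ 1 % R → n ≡ P₀ + n / R * R
  c*n%R≡1%R⇒n≡P₀+[n/R]*R c⊥R P₀<R n cn≡1 = begin
    n                 ≡⟨ m≡m%n+[m/n]*n n R ⟩
    n % R + n / R * R ≡⟨ cong (_+ n / R * R) n%R≡P₀ ⟩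
    P₀ + n / R * R    ∎
    where
    n%R≡P₀ : n % R ≡ P₀
    n%R≡P₀ = trans (c*m%d≡c*n%d⇒m%d≡n%d n P₀ (Coprimality.sym c⊥R) (trans cn≡1 (sym cP₀≡1)))
                   (m<n⇒m%n≡m P₀<R)

  solution⇔u+v≡S₀+c*t : ∀ t u v → u * v ≡ P₀ + t * R →
                         c * u * v ≡ R * (u + v) + 1 ⇔ u + v ≡ S₀ R c P₀ + c * t
  solution⇔u+v≡S₀+c*t t u v uv≡P₀+tR = mk⇔
    (λ eq → sym (*-cancelˡ-≡ _ _ R (+-cancelʳ-≡ 1 _ _ (trans (sym c*u*v≡R*s+1) eq))))
    (λ u+v≡s → trans c*u*v≡R*s+1 (cong (λ s → R * s + 1) (sym u+v≡s)))
    where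
    c*u*v≡R*s+1 : c * u * v ≡ R * (S₀ R c P₀ + c * t) + 1
    c*u*v≡R*s+1 = trans (*-assoc c u v) (trans (cong (c *_) uv≡P₀+tR) (c*[P₀+t*R]≡R*[S₀+c*t]+1 t))

  D≡k²⇔u*[u+k]≡P₀+t*R : ∀ t u k → S₀ R c P₀ + c * t ≡ 2 * u + k →
                         D R c P₀ t ≡ + (k * k) ⇔ u * (u + k) ≡ P₀ + t * R
  D≡k²⇔u*[u+k]≡P₀+t*R t u k s≡2u+k = mk⇔
    (λ D≡k² → *-cancelˡ-≡ _ _ 4 (+-cancelˡ-≡ (k * k) _ _
      (to (+m-+n≡+o⇔m≡o+n _ _ _) (trans (sym D≡expanded) D≡k²))))
    (λ q≡p → trans D≡expanded (from (+m-+n≡+o⇔m≡o+n _ _ _) (cong (λ q → k * k + 4 * q) q≡p)))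
    where
    s = S₀ R c P₀ + c * t
    square : ∀ u k → (2 * u + k) * (2 * u + k) ≡ k * k + 4 * (u * (u + k))
    square = solve-∀
    D≡expanded : D R c P₀ t ≡ + (k * k + 4 * (u * (u + k))) ℤ.- + (4 * (P₀ + t * R))
    D≡expanded = cong (ℤ._- + (4 * (P₀ + t * R))) (begin
      + s ℤ.* + s                      ≡⟨ ℤ.pos-* s s ⟨
      + (s * s)                        ≡⟨ cong +_ (trans (cong₂ _*_ s≡2u+k s≡2u+k) (square u k)) ⟩
      + (k * k + 4 * (u * (u + k)))    ∎)

  prime-solution⇒square-discriminant : Coprime c R → P₀ < R → ∀ {m} →
                                       PrimeSolution R c m → PrimeRootsOfSquareDiscriminant R c m P₀
  prime-solution⇒square-discriminant c⊥R P₀<R (u , v , pu , pv , u<v , m<u , eq)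
    with k , refl ← m≤n⇒∃[o]m+o≡n (<⇒≤ u<v) =
    t , k , from (D≡k²⇔u*[u+k]≡P₀+t*R t u k s≡2u+k) uv≡P₀+tR ,
    u , u + k , sym s≡2u+k , trans (2*[u+k]≡2*u+k+k u k) (cong (_+ k) (sym s≡2u+k)) , pu , pv , m<u
    where
    t = u * (u + k) / R
    uv≡P₀+tR : u * (u + k) ≡ P₀ + t * R
    uv≡P₀+tR = c*n%R≡1%R⇒n≡P₀+[n/R]*R c⊥R P₀<R _ (c*u*v≡R*[u+v]+1⇒c*[u*v]%R≡1%R R c u (u + k) eq)
    s≡2u+k : S₀ R c P₀ + c * t ≡ 2 * u + k
    s≡2u+k = trans (sym (to (solution⇔u+v≡S₀+c*t t u (u + k) uv≡P₀+tR) eq)) (u+[u+k]≡2*u+k u k)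

  square-discriminant⇒prime-solution : ∀ {m} → PrimeRootsOfSquareDiscriminant R c m P₀ → PrimeSolution R c m
  square-discriminant⇒prime-solution (t , k , D≡k² , u , v , 2u+k≡s , 2v≡s+k , pu , pv , m<u)
    with refl ← *-cancelˡ-≡ v (u + k) 2
                  (trans 2v≡s+k (trans (cong (_+ k) (sym 2u+k≡s)) (sym (2*[u+k]≡2*u+k+k u k)))) =
    u , u + k , pu , pv , ≤∧≢⇒< (m≤m+n u k) u≢u+k , m<u , eq
    where
    uv≡P₀+tR : u * (u + k) ≡ P₀ + t * R
    uv≡P₀+tR = to (D≡k²⇔u*[u+k]≡P₀+t*R t u k (sym 2u+k≡s)) D≡k²
    eq : c * u * (u + k) ≡ R * (u + (u + k)) + 1
    eq = from (solution⇔u+v≡S₀+c*t t u (u + k) uv≡P₀+tR) (trans (u+[u+k]≡2*u+k u k) 2u+k≡s)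
    u≢u+k : u ≢ u + k
    u≢u+k u≡u+k = ¬prime[1] (subst Prime (c*u*v≡R*[u+v]+1⇒u≡v⇒u≡1 R c u (u + k) eq u≡u+k) pu)

mainTheorem17 : (R c m P₀ : ℕ) → .{{_ : NonZero R}} → 1 ≤ c → Coprime c R → 1 ≤ m →
                1 ≤ P₀ → P₀ < R → (c * P₀) % R ≡ 1 % R →
                (∃ λ u → ∃ λ v → Prime u × Prime v × u < v × m < u × c * u * v ≡ R * (u + v) + 1)
                ⇔
                (∃ λ t → ∃ λ k → D R c P₀ t ≡ + (k * k) ×
                  (∃ λ u → ∃ λ v → 2 * u + k ≡ S₀ R c P₀ + c * t × 2 * v ≡ S₀ R c P₀ + c * t + k ×
                    Prime u × Prime v × m < u))
mainTheorem17 R c m P₀ 1≤c c⊥R _ 1≤P₀ P₀<R cP₀≡1 =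
  mk⇔ (prime-solution⇒square-discriminant R c P₀ 1≤c 1≤P₀ cP₀≡1 c⊥R P₀<R)
      (square-discriminant⇒prime-solution R c P₀ 1≤c 1≤P₀ cP₀≡1)
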